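{- For all $n\ge1$ and all finite sequences $\mathfrak a$ of interpretation variables: ${\sf FIL}\vdash D_n\rhd^{\mathfrak a}\Diamond\neg C\to\mathsf V_n$, where for arbitrary ${\sf FIL}$-formulas $C,D_1,D_2,\dots$: $\mathsf V_1:=\Box(D_1\rhd\neg C)$ and $\mathsf V_{m+1}:=\Box(D_m\rhd D_{m+1}\to\mathsf V_m)$ for $m\ge1$.
   Context: The logic ${\sf FIL}$: the language has propositional variables, interpretation variables $k_0,k_1,\dots$, one interpretation constant ${\sf id}$, $\top,\bot$, Boolean connectives and modalities $\Box^{\mathfrak a}A$, $A\rhd^{\mathfrak a}B$ where $\mathfrak a$ is a finite sequence of interpretation terms without repetition; unlabelled $\Box,\rhd$ stand for label ${\sf id}$ / the empty sequence; $\Diamond^{\mathfrak a}:=\neg\Box^{\mathfrak a}\neg$; $\mathfrak a,k$ is $\mathfrak a$ extended by $k$. Sequents $\Gamma\vdash C$ with $\Gamma$ a multiset, with $\Gamma,\Delta\vdash C$ iff $\Delta\vdash\bigwedge\Gamma\to C$. Axioms/rules (for all labels $\mathfrak a,\mathfrak b$, terms $k$): all tautologies; modus ponens; $\Box^{\mathfrak a}(A\to B)\to(\Box^{\mathfrak a}A\to\Box^{\mathfrak a}B)$; $\Box^{\mathfrak b}A\to\Box^{\mathfrak a}\Box^{\mathfrak b}A$; $\Box^{\mathfrak a}(\Box^{\mathfrak a}A\to A)\to\Box^{\mathfrak a}A$; $\Box^{\mathfrak a}(A\to B)\to A\rhd^{\mathfrak a}B$; $(A\rhd B)\wedge(B\rhd^{\mathfrak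 a}C)\to A\rhd^{\mathfrak a}C$; $(A\rhd^{\mathfrak a}B)\wedge\Box^{\mathfrak a}(B\to C)\to A\rhd^{\mathfrak a}C$; $(A\rhd^{\mathfrak a}C)\wedge(B\rhd^{\mathfrak a}C)\to A\vee B\rhd^{\mathfrak a}C$; $A\rhd^{\mathfrak a}B\to(\Diamond A\to\Diamond^{\mathfrak a}B)$; $A\rhd^{\mathfrak a}\Diamond^{\mathfrak b}B\to A\rhd^{\mathfrak b}B$; $\Box^{\mathfrak a,k}A\to\Box^{\mathfrak a}A$; $A\rhd^{\mathfrak a}B\to A\rhd^{\mathfrak a,k}B$; necessitation $\vdash A\Rightarrow\vdash\Box^{\mathfrak a}A$; rule $\mathsf P^{\mathfrak a,\mathfrak b,k}$: from $\Gamma,\Delta,\Box^{\mathfrak b}(A\rhd^{\mathfrak a,k}B)\vdash C$ infer $\Gamma,A\rhd^{\mathfrak a}B\vdash C$, provided $k$ is an interpretation variable not occurring in $\mathfrak a,\Gamma,A,B,C$ and $\Delta$ consists of formulas of the forms $E\rhd^{\mathfrak a,k}F\to E\rhd^{\mathfrak a}F$ and $\Box^{\mathfrak a}E\to\Box^{\mathfrak a,k}E$. Binding: $\neg,\Box,\Diamond$ strongest, Boolean connectives other than $\to$ bind stronger than $\rhd$, $\rhd$ stronger than $\to$. -}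

module Defs where

open import Data.Nat using (ℕ; zero; suc)
open import Data.Nat.Properties using () renaming (_≟_ to _≟ℕ_)
open import Data.Bool using (Bool; true; false; _∧_; _∨_; not; T)
open import Data.List using (List; []; _∷_; _∷ʳ_; _++_; foldr)
open import Data.Bool.ListAction using (any)
open import Data.List.Relation.Unary.All using (All)
open import Data.Product using (Σ; _,_; proj₁)
open import Data.Unit using (tt)
open import Relation.Nullary using (yes; no; ¬_)
open import Relation.Binary.PropositionalEquality using (_≡_)

data Term : Set where
  ivar : ℕ → Term
  idt  : Term

eqT : Term → Term → Bool
eqT (ivar m) (ivar n) with m ≟ℕ n
... | yes _ = true
... | no  _ = false
eqT (ivar _) idt = false
eqT idt (ivar _) = false
eqT idt idt = true

elemT : Term → List Term → Bool
elemT t = any (eqT t)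

noRep : List Term → Bool
noRep [] = true
noRep (t ∷ ts) = not (elemT t ts) ∧ noRep ts

Label : Set
Label = Σ (List Term) (λ l → T (noRep l))

emptyL : Label
emptyL = [] , tt

idL : Label
idL = (idt ∷ []) , tt

IsVar : Term → Set
IsVar (ivar _) = Data.Unit.⊤
IsVar idt = Data.Empty.⊥
  where import Data.Empty

infixr 4 _⇒_
infixr 5 _∨'_
infixr 6 _∧'_
infix 7 _▷_
infix 8 ¬'_

data Fm : Set where
  pv   : ℕ → Fm
  ⊤' ⊥' : Fm
  ¬'_  : Fm → Fm
  _∧'_ _∨'_ _⇒_ : Fm → Fm → Fm
  □^   : Label → Fm → Fm
  ▷^   : Label → Fm → Fm → Fm

◇^ : Label → Fm → Fm
◇^ a A = ¬' □^ a (¬' A)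

□ : Fm → Fm
□ = □^ idL

◇ : Fm → Fm
◇ = ◇^ idL

_▷_ : Fm → Fm → Fm
A ▷ B = ▷^ emptyL A B

occL : ℕ → List Term → Bool
occL k = any (eqT (ivar k))

occ : ℕ → Fm → Bool
occ k (pv _) = false
occ k ⊤' = false
occ k ⊥' = false
occ k (¬' A) = occ k A
occ k (A ∧' B) = occ k A ∨ occ k B
occ k (A ∨' B) = occ k A ∨ occ k B
occ k (A ⇒ B) = occ k A ∨ occ k B
occ k (□^ a A) = occL k (proj₁ a) ∨ occ k A
occ k (▷^ a A B) = occL k (proj₁ a) ∨ occ k A ∨ occ k B

occs : ℕ → List Fm → Bool
occs k = any (occ k)

-- Propositional tautologies: true under every assignment of truth values
-- to the propositionally atomic formulas (variables, □^𝔞 A, A ▷^𝔞 B)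

eval : (Fm → Bool) → Fm → Bool
eval v (pv p) = v (pv p)
eval v ⊤' = true
eval v ⊥' = false
eval v (¬' A) = not (eval v A)
eval v (A ∧' B) = eval v A ∧ eval v B
eval v (A ∨' B) = eval v A ∨ eval v B
eval v (A ⇒ B) = not (eval v A) ∨ eval v B
eval v (□^ a A) = v (□^ a A)
eval v (▷^ a A B) = v (▷^ a A B)

Taut : Fm → Set
Taut A = (v : Fm → Bool) → eval v A ≡ true

⋀ : List Fm → Fm
⋀ = foldr _∧'_ ⊤'

_Ext_by_ : Label → Label → Term → Set
ak Ext a by k = proj₁ ak ≡ proj₁ a ∷ʳ k

data DeltaFm (a ak : Label) : Fm → Set where
  δ▷ : ∀ E F → DeltaFm a ak (▷^ ak E F ⇒ ▷^ a E F)
  δ□ : ∀ E → DeltaFm a ak (□^ a E ⇒ □^ ak E)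

-- The logic FIL.  ⊢ A : A is a theorem.  A sequent Γ ⊢ C is
-- ⊢ ⋀Γ → C (multisets as lists; order is immaterial up to tautologies).

infix 2 ⊢_
data ⊢_ : Fm → Set where
  taut : ∀ {A} → Taut A → ⊢ A
  mp   : ∀ {A B} → ⊢ (A ⇒ B) → ⊢ A → ⊢ B
  axK  : ∀ a A B → ⊢ (□^ a (A ⇒ B) ⇒ (□^ a A ⇒ □^ a B))
  ax4  : ∀ a b A → ⊢ (□^ b A ⇒ □^ a (□^ b A))
  axL  : ∀ a A → ⊢ (□^ a (□^ a A ⇒ A) ⇒ □^ a A)
  axJ1 : ∀ a A B → ⊢ (□^ a (A ⇒ B) ⇒ ▷^ a A B)
  axJ2 : ∀ a A B C → ⊢ ((A ▷ B) ∧' ▷^ a B C ⇒ ▷^ a A C)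
  axJ2' : ∀ a A B C → ⊢ (▷^ a A B ∧' □^ a (B ⇒ C) ⇒ ▷^ a A C)
  axJ3 : ∀ a A B C → ⊢ (▷^ a A C ∧' ▷^ a B C ⇒ ▷^ a (A ∨' B) C)
  axJ4 : ∀ a A B → ⊢ (▷^ a A B ⇒ (◇ A ⇒ ◇^ a B))
  axJ5 : ∀ a b A B → ⊢ (▷^ a A (◇^ b B) ⇒ ▷^ b A B)
  axM□ : ∀ a ak k → ak Ext a by k → ∀ A → ⊢ (□^ ak A ⇒ □^ a A)
  axM▷ : ∀ a ak k → ak Ext a by k → ∀ A B → ⊢ (▷^ a A B ⇒ ▷^ ak A B)
  nec  : ∀ a {A} → ⊢ A → ⊢ □^ a A
  ruleP : ∀ a b ak k (Γ Δ : List Fm) A B C →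
          ak Ext a by ivar k →
          T (not (occL k (proj₁ a))) →
          T (not (occs k Γ)) → T (not (occ k A)) →
          T (not (occ k B)) → T (not (occ k C)) →
          All (DeltaFm a ak) Δ →
          ⊢ (⋀ (Γ ++ Δ ++ (□^ b (▷^ ak A B) ∷ [])) ⇒ C) →
          ⊢ (⋀ (Γ ++ (▷^ a A B ∷ [])) ⇒ C)

-- The formulas V_n (n ≥ 1); V 0 is an unused dummy value.

V : Fm → (ℕ → Fm) → ℕ → Fm
V C D zero = ⊤'
V C D (suc zero) = □ (D 1 ▷ ¬' C)
V C D (suc (suc m)) = □ ((D (suc m) ▷ D (suc (suc m))) ⇒ V C D (suc m))

{-# OPTIONS --safe #-}
-- By induction on n, simultaneously for all labels 𝔞. Rule P yields persistence:
-- if A ▷^{𝔞,k} B → E holds for every extension 𝔞,k then A ▷^𝔞 B → □E. For n = 1,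
-- J2' and J5 turn D₁ ▷^{𝔞,k} ◇¬C into D₁ ▷ ¬C, because ◇E → ◇^𝔟 E follows from J1
-- and J4. For n + 1, J2 composes D_n ▷ D_{n+1} with D_{n+1} ▷^{𝔞,k} ◇¬C, and the
-- induction hypothesis at the label 𝔞,k turns the result into V_n.
module Submission where

open import Defs
open import Data.Bool using (true; false; not; _∧_; _∨_; T)
open import Data.Bool.Properties using (∨-inverseˡ; ∨-zeroʳ; ∨-conicalˡ; ∨-conicalʳ; T-∧; T-not-≡)
open import Data.List using (List; []; _∷_; _∷ʳ_; foldr)
open import Data.List.Relation.Unary.All using (All; [])
open import Data.Nat using (ℕ; zero; suc; _≤_; _⊔_)
open import Data.Nat.Properties using (_≟_; ≤-refl; <-irrefl; m⊔n≤o⇒m≤o; m⊔n≤o⇒n≤o)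
open import Data.Product using (proj₁; proj₂; _,_)
open import Function using (Equivalence; _∘_)
open import Relation.Nullary using (yes; no; contradiction)
open import Relation.Binary.PropositionalEquality using (_≡_; refl; sym; trans; cong; cong₂; subst)

private
  variable
    A B C E : Fm

⇒-refl : ⊢ (A ⇒ A)
⇒-refl {A} = taut λ v → ∨-inverseˡ (eval v A)

⇒-trans : ⊢ (A ⇒ B) → ⊢ (B ⇒ C) → ⊢ (A ⇒ C)
⇒-trans {A} {B} {C} A⇒B B⇒C =
  mp (mp (taut λ v → valid (eval v A) (eval v B) (eval v C)) A⇒B) B⇒C
  where
  valid : ∀ x y z → not (not x ∨ y) ∨ (not (not y ∨ z) ∨ (not x ∨ z)) ≡ true
  valid true  false _ = refl
  valid true  true  z = ∨-inverseˡ z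
  valid false y     z = ∨-zeroʳ (not (not y ∨ z))

∧-curry : ⊢ (A ∧' B ⇒ C) → ⊢ (B ⇒ A ⇒ C)
∧-curry {A} {B} {C} A∧B⇒C = mp (taut λ v → valid (eval v A) (eval v B) (eval v C)) A∧B⇒C
  where
  valid : ∀ x y z → not (not (x ∧ y) ∨ z) ∨ (not y ∨ (not x ∨ z)) ≡ true
  valid false y _ = ∨-zeroʳ (not y)
  valid true  y z = ∨-inverseˡ (not y ∨ z)

∧⊤-intro : ⊢ (A ⇒ A ∧' ⊤')
∧⊤-intro {A} = taut λ v → valid (eval v A)
  where
  valid : ∀ x → not x ∨ (x ∧ true) ≡ true
  valid true  = refl
  valid false = refl

∧⊤-elim : ⊢ (A ∧' ⊤' ⇒ A)
∧⊤-elim {A} = taut λ v → valid (eval v A)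
  where
  valid : ∀ x → not (x ∧ true) ∨ x ≡ true
  valid true  = refl
  valid false = refl

□-mono : ∀ a → ⊢ (A ⇒ B) → ⊢ (□^ a A ⇒ □^ a B)
□-mono {A} {B} a A⇒B = mp (axK a A B) (nec a A⇒B)

▷-monoʳ : ∀ a → ⊢ (B ⇒ C) → ⊢ (▷^ a A B ⇒ ▷^ a A C)
▷-monoʳ {B} {C} {A} a B⇒C = mp (∧-curry (axJ2' a A B C)) (nec a B⇒C)

◇⇒◇^ : ∀ a A → ⊢ (◇ A ⇒ ◇^ a A)
◇⇒◇^ a A = mp (axJ4 a A A) (mp (axJ1 a A A) (nec a ⇒-refl))

▷◇⇒▷^ : ∀ a b A B → ⊢ (▷^ a A (◇ B) ⇒ ▷^ b A B)
▷◇⇒▷^ a b A B = ⇒-trans (▷-monoʳ a (◇⇒◇^ b B)) (axJ5 a b A B)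

termBound : Term → ℕ
termBound (ivar m) = suc m
termBound idt      = zero

labelBound : List Term → ℕ
labelBound = foldr (λ t n → termBound t ⊔ n) zero

fmBound : Fm → ℕ
fmBound (pv _)     = zero
fmBound ⊤'         = zero
fmBound ⊥'         = zero
fmBound (¬' A)     = fmBound A
fmBound (A ∧' B)   = fmBound A ⊔ fmBound B
fmBound (A ∨' B)   = fmBound A ⊔ fmBound B
fmBound (A ⇒ B)    = fmBound A ⊔ fmBound B
fmBound (□^ a A)   = labelBound (proj₁ a) ⊔ fmBound A
fmBound (▷^ a A B) = labelBound (proj₁ a) ⊔ (fmBound A ⊔ fmBound B)

eqT-comm : ∀ s t → eqT s t ≡ eqT t s
eqT-comm (ivar m) (ivar n) with m ≟ n | n ≟ m
... | yes _   | yes _   = refl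
... | no  _   | no  _   = refl
... | yes m≡n | no  n≢m = contradiction (sym m≡n) n≢m
... | no  m≢n | yes n≡m = contradiction (sym n≡m) m≢n
eqT-comm (ivar _) idt      = refl
eqT-comm idt      (ivar _) = refl
eqT-comm idt      idt      = refl

eqT-fresh : ∀ {k} t → termBound t ≤ k → eqT (ivar k) t ≡ false
eqT-fresh {k} (ivar m) m<k with k ≟ m
... | yes refl = contradiction m<k (<-irrefl refl)
... | no  _    = refl
eqT-fresh idt _ = refl

∨-fresh : ∀ {m n k x y} → (m ≤ k → x ≡ false) → (n ≤ k → y ≡ false) →
          m ⊔ n ≤ k → x ∨ y ≡ false
∨-fresh {m} {n} x-fresh y-fresh m⊔n≤k =
  cong₂ _∨_ (x-fresh (m⊔n≤o⇒m≤o m n m⊔n≤k)) (y-fresh (m⊔n≤o⇒n≤o m n m⊔n≤k))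

occL-fresh : ∀ {k} l → labelBound l ≤ k → occL k l ≡ false
occL-fresh []       _ = refl
occL-fresh (t ∷ ts)   = ∨-fresh (eqT-fresh t) (occL-fresh ts)

occ-fresh : ∀ {k} A → fmBound A ≤ k → occ k A ≡ false
occ-fresh (pv _)     _ = refl
occ-fresh ⊤'         _ = refl
occ-fresh ⊥'         _ = refl
occ-fresh (¬' A)       = occ-fresh A
occ-fresh (A ∧' B)     = ∨-fresh (occ-fresh A) (occ-fresh B)
occ-fresh (A ∨' B)     = ∨-fresh (occ-fresh A) (occ-fresh B)
occ-fresh (A ⇒ B)      = ∨-fresh (occ-fresh A) (occ-fresh B)
occ-fresh (□^ a A)     = ∨-fresh (occL-fresh (proj₁ a)) (occ-fresh A)
occ-fresh (▷^ a A B)   = ∨-fresh (occL-fresh (proj₁ a)) (∨-fresh (occ-fresh A) (occ-fresh B))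

elemT-∷ʳ : ∀ t {x} ts → eqT t x ≡ false → elemT t (ts ∷ʳ x) ≡ elemT t ts
elemT-∷ʳ t []       t≠x = cong (_∨ false) t≠x
elemT-∷ʳ t (s ∷ ts) t≠x = cong (eqT t s ∨_) (elemT-∷ʳ t ts t≠x)

noRep-∷ʳ : ∀ {k} l → occL k l ≡ false → T (noRep l) → T (noRep (l ∷ʳ ivar k))
noRep-∷ʳ         []       _        _      = _
noRep-∷ʳ {k} (t ∷ ts) k∉t∷ts noRep-t∷ts =
  Equivalence.from T-∧ (subst (T ∘ not) (sym t∉ts∷ʳk) t∉ts , noRep-∷ʳ ts k∉ts noRep-ts)
  where
  k∉ts : occL k ts ≡ false
  k∉ts = ∨-conicalʳ _ _ k∉t∷ts
  t∉ts∷ʳk : elemT t (ts ∷ʳ ivar k) ≡ elemT t ts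
  t∉ts∷ʳk = elemT-∷ʳ t ts (trans (eqT-comm t (ivar k)) (∨-conicalˡ _ _ k∉t∷ts))
  t∉ts : T (not (elemT t ts))
  t∉ts = proj₁ (Equivalence.to T-∧ noRep-t∷ts)
  noRep-ts : T (noRep ts)
  noRep-ts = proj₂ (Equivalence.to T-∧ noRep-t∷ts)

persistence : ∀ {a b A B E} →
              (∀ ak k → ak Ext a by ivar k → ⊢ (▷^ ak A B ⇒ E)) →
              ⊢ (▷^ a A B ⇒ □^ b E)
persistence {a} {b} {A} {B} {E} on-extensions =
  ⇒-trans ∧⊤-intro
    (ruleP a b ak k [] [] A B (□^ b E) refl
       (T-not k∉a) _ (T-not k∉A) (T-not k∉B) (T-not k∉□E) [] premise)
  where
  k : ℕ
  k = fmBound (▷^ a A B ⇒ □^ b E)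
  k∉▷⇒□ : occ k (▷^ a A B ⇒ □^ b E) ≡ false
  k∉▷⇒□ = occ-fresh (▷^ a A B ⇒ □^ b E) ≤-refl
  k∉▷ : occ k (▷^ a A B) ≡ false
  k∉▷ = ∨-conicalˡ (occ k (▷^ a A B)) _ k∉▷⇒□
  k∉□E : occ k (□^ b E) ≡ false
  k∉□E = ∨-conicalʳ (occ k (▷^ a A B)) _ k∉▷⇒□
  k∉a : occL k (proj₁ a) ≡ false
  k∉a = ∨-conicalˡ (occL k (proj₁ a)) _ k∉▷
  k∉A∨B : occ k A ∨ occ k B ≡ false
  k∉A∨B = ∨-conicalʳ (occL k (proj₁ a)) _ k∉▷
  k∉A : occ k A ≡ false
  k∉A = ∨-conicalˡ (occ k A) _ k∉A∨B
  k∉B : occ k B ≡ false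
  k∉B = ∨-conicalʳ (occ k A) _ k∉A∨B
  T-not : ∀ {x} → x ≡ false → T (not x)
  T-not = Equivalence.from T-not-≡
  ak : Label
  ak = proj₁ a ∷ʳ ivar k , noRep-∷ʳ (proj₁ a) k∉a (proj₂ a)
  premise : ⊢ (□^ b (▷^ ak A B) ∧' ⊤' ⇒ □^ b E)
  premise = ⇒-trans ∧⊤-elim (□-mono b (on-extensions ak k refl))

▷◇¬⇒V : ∀ n a C D → ⊢ (▷^ a (D (suc n)) (◇ (¬' C)) ⇒ V C D (suc n))
▷◇¬⇒V zero    a C D = persistence λ ak _ _ → ▷◇⇒▷^ ak emptyL (D 1) (¬' C)
▷◇¬⇒V (suc n) a C D = persistence λ ak _ _ →
  ∧-curry (⇒-trans (axJ2 ak (D (suc n)) (D (suc (suc n))) (◇ (¬' C))) (▷◇¬⇒V n ak C D))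

mainTheorem18 : (n : ℕ) → 1 ≤ n → (a : Label) → All IsVar (proj₁ a) →
    (C : Fm) (D : ℕ → Fm) →
    ⊢ (▷^ a (D n) (◇ (¬' C)) ⇒ V C D n)
mainTheorem18 (suc n) _ a _ = ▷◇¬⇒V n a
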